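{- Let $G_3$ be the graph with vertices $v_1,\dots,v_8$ and edges $a_1=v_1v_2$, $a_2=v_2v_3$, $a_3=v_3v_4$, $a_4=v_4v_5$, $a_5=v_1v_5$, $a_6=v_1v_8$, $a_7=v_2v_6$, $a_8=v_3v_6$, $a_9=v_4v_7$, $a_{10}=v_5v_8$, $a_{11}=v_6v_7$, $a_{12}=v_7v_8$, and let ${\gamma}_1=e_1+e_3+e_{10}+e_{11}$, ${\gamma}_2=e_2+e_4+e_6+e_{11}$, ${\gamma}_3=e_3+e_5+e_7+e_{12}$, ${\gamma}_4=e_2+e_5+e_6+e_7+e_8+2e_9+e_{10}$, ${\gamma}_5=e_2+e_3+e_5+e_6+e_7+e_9+e_{10}+e_{11}$. Every ${\gamma}\in S_\mathbb{R}(G_3)$ is uniquely ${\gamma}=\sum_{i=1}^5k_i{\gamma}_i$ with $(k_1,\dots,k_5)\in\mathbb{R}^5$; identify ${\gamma}$ with $(k_1,\dots,k_5)$. Consider the properties (in each, additionally $k_i\in\mathbb{N}$ for $1\le i\le4$): $P_a$: $k_5\in\mathbb{N}$; $P_b$: $-k_5\in\mathbb{P}$ and $\min\{k_1,k_4\}\ge -k_5$; $P_{c_1}$: $-k_5\in\mathbb{P}$, $\min\{k_1,k_4\}<-k_5$, $k_1\ge k_4$; $P_{c_2}$: $-k_5\in\mathbb{P}$, $\min\{k_1,k_4\}<-k_5$, $k_1<k_4$, $2k_1+k_5\ge0$; $P_{c_3}$: $-k_5\in\mathbb{P}$, $\min\{k_1,k_4\}<-k_5$, $k_1<k_4$, $2k_1+k_5<0$.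 For $h\in\{a,b,c_1,c_2,c_3\}$ define $(l_1,\dots,l_5)$ as functions of $(k_1,\dots,k_5)$ by: $h=a$: $(k_1,\ k_2,\ k_3,\ k_4,\ k_5)$; $h=b$: $(k_1+k_5,\ k_2,\ k_3,\ k_4+k_5,\ -k_5-1)$; $h=c_1$: $(k_1-k_4,\ k_2+k_4+k_5,\ k_3+k_4+k_5,\ -k_5-k_4-1,\ 2k_4+k_5)$; $h=c_2$: $(k_2+k_1+k_5,\ k_3+k_1+k_5,\ k_4-k_1-1,\ -k_5-k_1-1,\ 2k_1+k_5)$; $h=c_3$: $(k_2+k_1+k_5,\ k_3+k_1+k_5,\ k_4+k_1+k_5,\ k_1,\ -k_5-2k_1-1)$. Then for each $h$, the set $P_h(S(G_3))$ of elements of $S(G_3)$ satisfying $P_h$ equals the set of $(k_1,\dots,k_5)\in\mathbb{R}^5$ whose corresponding $(l_1,\dots,l_5)$ lies in $\mathbb{N}^5$.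
   Context: For a finite graph $G$ with edges $a_1,\dots,a_n$, a labelling is a vector ${\alpha}$ assigning $\alpha_k$ to edge $a_k$; the weight of a vertex is the sum of labels of incident edges. $S_\mathbb{R}(G)$ is the set of ${\alpha}\in\mathbb{R}^n$ with all vertex weights equal; $S(G)=S_\mathbb{R}(G)\cap\mathbb{N}^n$ is the set of magic labellings. $\mathbb{N}=\{0,1,2,\dots\}$, $\mathbb{P}=\{1,2,\dots\}$, $e_i$ is the $i$-th unit vector of $\mathbb{R}^{12}$.
   Formalization: The coordinates $(k_1,\dots,k_5)$ and the edge labels, including those of the labellings in $S_\mathbb{R}(G_3)$, are rational rather than real. -}

module Defs where

open import Data.Nat using (ℕ; suc)
open import Data.Integer using (+_)
open import Data.Rational using (ℚ; _/_; 0ℚ; _+_; _*_; -_; _≤_; _<_; _⊓_)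
open import Data.Fin using (Fin; zero; suc; _≟_)
open import Data.Fin.Patterns

pattern 10F = suc 9F
pattern 11F = suc 10F
open import Data.List using (List; foldr; map)
open import Data.List using () renaming (allFin to allFinL)
open import Data.Product using (Σ; _×_)
open import Relation.Binary.PropositionalEquality using (_≡_)
open import Relation.Nullary.Decidable using (does)
open import Data.Bool using (if_then_else_; _∨_)

-- Rationals stand in for the reals (no real numbers in agda-stdlib).

ℕ→ℚ : ℕ → ℚ
ℕ→ℚ n = + n / 1

IsNat : ℚ → Set
IsNat q = Σ ℕ λ n → q ≡ ℕ→ℚ n

IsPos : ℚ → Set
IsPos q = Σ ℕ λ n → q ≡ ℕ→ℚ (suc n)

Σℚ : (n : ℕ) → (Fin n → ℚ) → ℚ
Σℚ n f = foldr _+_ 0ℚ (map f (allFinL n))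

-- The graph G₃: vertices v₁..v₈ are 0F..7F, edges a₁..a₁₂ are 0F..11F.

Vertex : Set
Vertex = Fin 8

Edge : Set
Edge = Fin 12

ends : Edge → Vertex × Vertex
ends 0F  = 0F Data.Product., 1F
ends 1F  = 1F Data.Product., 2F
ends 2F  = 2F Data.Product., 3F
ends 3F  = 3F Data.Product., 4F
ends 4F  = 0F Data.Product., 4F
ends 5F  = 0F Data.Product., 7F
ends 6F  = 1F Data.Product., 5F
ends 7F  = 2F Data.Product., 5F
ends 8F  = 3F Data.Product., 6F
ends 9F  = 4F Data.Product., 7F
ends 10F = 5F Data.Product., 6F
ends 11F = 6F Data.Product., 7F

incident : Vertex → Edge → Data.Bool.Bool
incident v e = does (v ≟ Data.Product.proj₁ (ends e)) ∨ does (v ≟ Data.Product.proj₂ (ends e))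

Labelling : Set
Labelling = Edge → ℚ

weight : Labelling → Vertex → ℚ
weight α v = Σℚ 12 λ e → if incident v e then α e else 0ℚ

InSR : Labelling → Set
InSR α = (v w : Vertex) → weight α v ≡ weight α w

InS : Labelling → Set
InS α = InSR α × ((e : Edge) → IsNat (α e))

-- The vectors γ₁..γ₅ (index 0F..4F), coordinates e₁..e₁₂ are 0F..11F.

γ : Fin 5 → Labelling
γ 0F 0F = ℕ→ℚ 1
γ 0F 2F = ℕ→ℚ 1
γ 0F 9F = ℕ→ℚ 1
γ 0F 10F = ℕ→ℚ 1
γ 1F 1F = ℕ→ℚ 1
γ 1F 3F = ℕ→ℚ 1
γ 1F 5F = ℕ→ℚ 1
γ 1F 10F = ℕ→ℚ 1
γ 2F 2F = ℕ→ℚ 1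
γ 2F 4F = ℕ→ℚ 1
γ 2F 6F = ℕ→ℚ 1
γ 2F 11F = ℕ→ℚ 1
γ 3F 1F = ℕ→ℚ 1
γ 3F 4F = ℕ→ℚ 1
γ 3F 5F = ℕ→ℚ 1
γ 3F 6F = ℕ→ℚ 1
γ 3F 7F = ℕ→ℚ 1
γ 3F 8F = ℕ→ℚ 2
γ 3F 9F = ℕ→ℚ 1
γ 4F 1F = ℕ→ℚ 1
γ 4F 2F = ℕ→ℚ 1
γ 4F 4F = ℕ→ℚ 1
γ 4F 5F = ℕ→ℚ 1
γ 4F 6F = ℕ→ℚ 1
γ 4F 8F = ℕ→ℚ 1
γ 4F 9F = ℕ→ℚ 1
γ 4F 10F = ℕ→ℚ 1
γ _ _ = 0ℚ

K5 : Set
K5 = Fin 5 → ℚ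

comb : K5 → Labelling
comb k e = Σℚ 5 λ i → k i * γ i e

data H : Set where
  a b c₁ c₂ c₃ : H

Base : K5 → Set
Base k = IsNat (k 0F) × IsNat (k 1F) × IsNat (k 2F) × IsNat (k 3F)

P : H → K5 → Set
P a  k = Base k × IsNat (k 4F)
P b  k = Base k × IsPos (- k 4F) × (- k 4F ≤ k 0F ⊓ k 3F)
P c₁ k = Base k × IsPos (- k 4F) × (k 0F ⊓ k 3F < - k 4F) × (k 3F ≤ k 0F)
P c₂ k = Base k × IsPos (- k 4F) × (k 0F ⊓ k 3F < - k 4F) × (k 0F < k 3F)
           × (0ℚ ≤ ℕ→ℚ 2 * k 0F + k 4F)
P c₃ k = Base k × IsPos (- k 4F) × (k 0F ⊓ k 3F < - k 4F) × (k 0F < k 3F)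
           × (ℕ→ℚ 2 * k 0F + k 4F < 0ℚ)

one : ℚ
one = ℕ→ℚ 1

l : H → K5 → K5
l a k i = k i
l b k 0F = k 0F + k 4F
l b k 1F = k 1F
l b k 2F = k 2F
l b k 3F = k 3F + k 4F
l b k 4F = - k 4F + - one
l c₁ k 0F = k 0F + - k 3F
l c₁ k 1F = k 1F + k 3F + k 4F
l c₁ k 2F = k 2F + k 3F + k 4F
l c₁ k 3F = - k 4F + - k 3F + - one
l c₁ k 4F = ℕ→ℚ 2 * k 3F + k 4F
l c₂ k 0F = k 1F + k 0F + k 4F
l c₂ k 1F = k 2F + k 0F + k 4F
l c₂ k 2F = k 3F + - k 0F + - one
l c₂ k 3F = - k 4F + - k 0F + - one
l c₂ k 4F = ℕ→ℚ 2 * k 0F + k 4F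
l c₃ k 0F = k 1F + k 0F + k 4F
l c₃ k 1F = k 2F + k 0F + k 4F
l c₃ k 2F = k 3F + k 0F + k 4F
l c₃ k 3F = k 0F
l c₃ k 4F = - k 4F + - (ℕ→ℚ 2 * k 0F) + - one

{-# OPTIONS --safe #-}
-- Each γᵢ is a magic labelling and vertex weights are linear, so Σ kᵢ γᵢ always lies in
-- S_ℝ(G₃); it lies in S(G₃) iff its ten distinct edge labels (k₁, k₂, k₃, k₄ and
-- k₂+k₄+k₅, k₃+k₁+k₅, k₃+k₄+k₅, 2k₄+k₅, k₄+k₁+k₅, k₂+k₁+k₅) are natural numbers.
-- For each h, every lᵢ is an integral combination of these labels plus a constant, made
-- non-negative by P_h; conversely every label and every condition of P_h is a sum of
-- some lᵢ plus a constant. Everything being integral, q < p amounts to p - q - 1 ∈ ℕ: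
-- this is how the strict inequalities of P_h match the shifts by -1 in the lᵢ.
module Submission where

open import Algebra.Bundles using (CommutativeRing)
open import Data.Bool using (true; false; if_then_else_)
open import Data.Empty using (⊥-elim)
open import Data.Fin using (Fin; zero; suc)
open import Data.Fin.Patterns
open import Data.Fin.Properties using (all?)
import Data.Integer as ℤ
import Data.Integer.Properties as ℤ
open import Data.List using (foldr; allFin; tabulate)
open import Data.List.Properties using (map-tabulate)
open import Data.Nat as ℕ using (ℕ; suc; _∸_)
import Data.Nat.Coprimality as Coprime
import Data.Nat.Properties as ℕ
open import Data.Product using (_×_; _,_; map₁)
open import Data.Rational using (ℚ; mkℚ; 0ℚ; _+_; _*_; -_; _-_; _/_; _≤_; _<_; _⊓_; *≤*)
open import Data.Rational.Properties
open import Data.Rational.Solver using (module +-*-Solver)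
import Data.Vec as Vec
open import Function using (_∘_; id)
open import Function.Bundles using (_⇔_; mk⇔; Equivalence)
open import Relation.Binary.PropositionalEquality
open import Relation.Nullary.Decidable using (toWitness)

open import Defs

open import Algebra.Properties.Semiring.Sum (CommutativeRing.semiring +-*-commutativeRing)
  using (sum; sum-cong-≗; sum-replicate-zero; ∑-comm; *-distribˡ-sum)
open +-*-Solver using (Polynomial; var; con; _:+_; _:-_; _:*_; :-_; _:=_; ⟦_⟧; ⟦_⟧↓; prove; solve)
open ≡-Reasoning

ℕ→ℚ-canonical : ∀ n → ℕ→ℚ n ≡ mkℚ (ℤ.+ n) 0 (Coprime.sym (Coprime.1-coprimeTo n))
ℕ→ℚ-canonical n = normalize-coprime (Coprime.sym (Coprime.1-coprimeTo n))

-- The middle term is, by definition of _+_ on ℚ, the sum of the canonical forms.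
ℕ→ℚ-homo-+ : ∀ m n → ℕ→ℚ (m ℕ.+ n) ≡ ℕ→ℚ m + ℕ→ℚ n
ℕ→ℚ-homo-+ m n = begin
  ℤ.+ (m ℕ.+ n) / 1                          ≡⟨ cong (_/ 1) (trans (ℤ.pos-+ m n) (sym m*1+n*1≡m+n)) ⟩
  (ℤ.+ m ℤ.* ℤ.+ 1 ℤ.+ ℤ.+ n ℤ.* ℤ.+ 1) / 1  ≡⟨ cong₂ _+_ (ℕ→ℚ-canonical m) (ℕ→ℚ-canonical n) ⟨
  ℕ→ℚ m + ℕ→ℚ n                              ∎
  where
  m*1+n*1≡m+n : ℤ.+ m ℤ.* ℤ.+ 1 ℤ.+ ℤ.+ n ℤ.* ℤ.+ 1 ≡ ℤ.+ m ℤ.+ ℤ.+ n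
  m*1+n*1≡m+n = cong₂ ℤ._+_ (ℤ.*-identityʳ (ℤ.+ m)) (ℤ.*-identityʳ (ℤ.+ n))

ℕ→ℚ-cancel-≤ : ∀ {m n} → ℕ→ℚ m ≤ ℕ→ℚ n → m ℕ.≤ n
ℕ→ℚ-cancel-≤ {m} {n} m≤n with *≤* m*1≤n*1 ← subst₂ _≤_ (ℕ→ℚ-canonical m) (ℕ→ℚ-canonical n) m≤n =
  ℤ.drop‿+≤+ (subst₂ ℤ._≤_ (ℤ.*-identityʳ (ℤ.+ m)) (ℤ.*-identityʳ (ℤ.+ n)) m*1≤n*1)

p-q+q≡p : ∀ p q → p - q + q ≡ p
p-q+q≡p = solve 2 (λ p q → p :- q :+ q := p) refl

p+q-q≡p : ∀ p q → p + q - q ≡ p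
p+q-q≡p = solve 2 (λ p q → p :+ q :- q := p) refl

p-[-q]≡p+q : ∀ p q → p - - q ≡ p + q
p-[-q]≡p+q = solve 2 (λ p q → p :- :- q := p :+ q) refl

2*p≡p+p : ∀ p → ℕ→ℚ 2 * p ≡ p + p
2*p≡p+p = solve 1 (λ p → con (ℕ→ℚ 2) :* p := p :+ p) refl

p-q≥0⇒q≤p : ∀ {p q} → 0ℚ ≤ p - q → q ≤ p
p-q≥0⇒q≤p {p} {q} 0≤p-q = subst₂ _≤_ (+-identityˡ q) (p-q+q≡p p q) (+-monoˡ-≤ q 0≤p-q)

p-q>0⇒q<p : ∀ {p q} → 0ℚ < p - q → q < p
p-q>0⇒q<p {p} {q} 0<p-q = subst₂ _<_ (+-identityˡ q) (p-q+q≡p p q) (+-monoˡ-< q 0<p-q)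

q<p⇒p-q>0 : ∀ {p q} → q < p → 0ℚ < p - q
q<p⇒p-q>0 {p} {q} q<p = subst (_< p - q) (+-inverseʳ q) (+-monoˡ-< (- q) q<p)

p+q<0⇒p<-q : ∀ {p q} → p + q < 0ℚ → p < - q
p+q<0⇒p<-q {p} {q} p+q<0 = subst₂ _<_ (p+q-q≡p p q) (+-identityˡ (- q)) (+-monoˡ-< (- q) p+q<0)

p<-q⇒p+q<0 : ∀ {p q} → p < - q → p + q < 0ℚ
p<-q⇒p+q<0 {p} {q} p<-q = subst (p + q <_) (+-inverseˡ q) (+-monoˡ-< q p<-q)

isNat-1 : IsNat one
isNat-1 = 1 , refl

isNat-+ : ∀ {p q} → IsNat p → IsNat q → IsNat (p + q)
isNat-+ (m , refl) (n , refl) = m ℕ.+ n , sym (ℕ→ℚ-homo-+ m n)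

isNat-2* : ∀ {p} → IsNat p → IsNat (ℕ→ℚ 2 * p)
isNat-2* {p} p∈ℕ = subst IsNat (sym (2*p≡p+p p)) (isNat-+ p∈ℕ p∈ℕ)

isNat⇒nonNeg : ∀ {p} → IsNat p → 0ℚ ≤ p
isNat⇒nonNeg (n , refl) = subst (0ℚ ≤_) (sym (ℕ→ℚ-canonical n)) (nonNegative⁻¹ _)

isPos⇒pos : ∀ {p} → IsPos p → 0ℚ < p
isPos⇒pos (n , refl) = subst (0ℚ <_) (sym (ℕ→ℚ-canonical (suc n))) (positive⁻¹ _)

isPos⇒isNat : ∀ {p} → IsPos p → IsNat p
isPos⇒isNat (n , refl) = suc n , refl

isNat∧pos⇒isPos : ∀ {p} → IsNat p → 0ℚ < p → IsPos p
isNat∧pos⇒isPos (0     , refl) 0<0 = ⊥-elim (<-irrefl refl 0<0)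
isNat∧pos⇒isPos (suc n , refl) _   = n , refl

isPos⇒isNat-pred : ∀ {p} → IsPos p → IsNat (p - one)
isPos⇒isNat-pred (n , refl) = n , (begin
  ℕ→ℚ (suc n) - one  ≡⟨ cong (_- one) (trans (cong ℕ→ℚ (ℕ.+-comm 1 n)) (ℕ→ℚ-homo-+ n 1)) ⟩
  ℕ→ℚ n + one - one  ≡⟨ p+q-q≡p (ℕ→ℚ n) one ⟩
  ℕ→ℚ n              ∎)

isNat-pred⇒isPos : ∀ {p} → IsNat (p - one) → IsPos p
isNat-pred⇒isPos {p} (n , p-1≡n) = n , (begin
  p              ≡⟨ p-q+q≡p p one ⟨
  p - one + one  ≡⟨ cong (_+ one) p-1≡n ⟩
  ℕ→ℚ n + one    ≡⟨ ℕ→ℚ-homo-+ n 1 ⟨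
  ℕ→ℚ (n ℕ.+ 1)  ≡⟨ cong ℕ→ℚ (ℕ.+-comm n 1) ⟩
  ℕ→ℚ (suc n)    ∎)

isNat-diff : ∀ {p q} → IsNat p → IsNat q → q ≤ p → IsNat (p - q)
isNat-diff (m , refl) (n , refl) n≤m = m ∸ n , (begin
  ℕ→ℚ m - ℕ→ℚ n                ≡⟨ cong (λ x → ℕ→ℚ x - ℕ→ℚ n) (ℕ.m∸n+n≡m n≤ℕm) ⟨
  ℕ→ℚ (m ∸ n ℕ.+ n) - ℕ→ℚ n    ≡⟨ cong (_- ℕ→ℚ n) (ℕ→ℚ-homo-+ (m ∸ n) n) ⟩
  ℕ→ℚ (m ∸ n) + ℕ→ℚ n - ℕ→ℚ n  ≡⟨ p+q-q≡p (ℕ→ℚ (m ∸ n)) (ℕ→ℚ n) ⟩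
  ℕ→ℚ (m ∸ n)                  ∎)
  where
  n≤ℕm : n ℕ.≤ m
  n≤ℕm = ℕ→ℚ-cancel-≤ n≤m

isNat-diff-1 : ∀ {p q} → IsNat p → IsNat q → q < p → IsNat (p - q - one)
isNat-diff-1 p∈ℕ q∈ℕ q<p =
  isPos⇒isNat-pred (isNat∧pos⇒isPos (isNat-diff p∈ℕ q∈ℕ (<⇒≤ q<p)) (q<p⇒p-q>0 q<p))

isNat-nonNeg-diff : ∀ {p q r} → IsNat p → IsNat q → r ≡ p - q → 0ℚ ≤ r → IsNat r
isNat-nonNeg-diff p∈ℕ q∈ℕ refl 0≤p-q = isNat-diff p∈ℕ q∈ℕ (p-q≥0⇒q≤p 0≤p-q)

isNat-diff⇒≤ : ∀ {p q} → IsNat (p - q) → q ≤ p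
isNat-diff⇒≤ p-q∈ℕ = p-q≥0⇒q≤p (isNat⇒nonNeg p-q∈ℕ)

isNat-diff-1⇒< : ∀ {p q} → IsNat (p - q - one) → q < p
isNat-diff-1⇒< p-q-1∈ℕ = p-q>0⇒q<p (isPos⇒pos (isNat-pred⇒isPos p-q-1∈ℕ))

isNat-diff⇒isNat : ∀ {p q} → IsNat (p - q) → IsNat q → IsNat p
isNat-diff⇒isNat {p} {q} p-q∈ℕ q∈ℕ = subst IsNat (p-q+q≡p p q) (isNat-+ p-q∈ℕ q∈ℕ)

isNat-diff-1⇒isPos : ∀ {p q} → IsNat (p - q - one) → IsNat q → IsPos p
isNat-diff-1⇒isPos {p} {q} p-q-1∈ℕ q∈ℕ =
  isNat-pred⇒isPos (subst IsNat p-q-1+q≡p-1 (isNat-+ p-q-1∈ℕ q∈ℕ))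
  where
  p-q-1+q≡p-1 : p - q - one + q ≡ p - one
  p-q-1+q≡p-1 = solve 2 (λ p q → p :- q :- con one :+ q := p :- con one) refl p q

isNat-+-assoc : ∀ {x} y z → IsNat x → IsNat (y + z) → IsNat (x + y + z)
isNat-+-assoc {x} y z x∈ℕ y+z∈ℕ = subst IsNat (sym (+-assoc x y z)) (isNat-+ x∈ℕ y+z∈ℕ)

isNat-2*-+ : ∀ x z → IsNat (x + x + z) → IsNat (ℕ→ℚ 2 * x + z)
isNat-2*-+ x z = subst IsNat (cong (_+ z) (sym (2*p≡p+p x)))

isNat-2*-+⁻ : ∀ x z → IsNat (ℕ→ℚ 2 * x + z) → IsNat (x + x + z)
isNat-2*-+⁻ x z = subst IsNat (cong (_+ z) (2*p≡p+p x))

isNat-exchange : ∀ x y z w → IsNat (x + y + z) → IsNat (w - y) → IsNat (x + w + z)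
isNat-exchange x y z w x+y+z∈ℕ w-y∈ℕ = subst IsNat x+y+z+[w-y]≡x+w+z (isNat-+ x+y+z∈ℕ w-y∈ℕ)
  where
  x+y+z+[w-y]≡x+w+z : x + y + z + (w - y) ≡ x + w + z
  x+y+z+[w-y]≡x+w+z = solve 4 (λ x y z w → x :+ y :+ z :+ (w :- y) := x :+ w :+ z) refl x y z w

isNat-cancel : ∀ {x} y z → IsNat (x + y + z) → IsNat (- z - y - one) → IsNat x
isNat-cancel {x} y z x+y+z∈ℕ -z-y-1∈ℕ =
  subst IsNat x+y+z+[-z-y-1]+1≡x (isNat-+ (isNat-+ x+y+z∈ℕ -z-y-1∈ℕ) isNat-1)
  where
  x+y+z+[-z-y-1]+1≡x : x + y + z + (- z - y - one) + one ≡ x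
  x+y+z+[-z-y-1]+1≡x =
    solve 3 (λ x y z → x :+ y :+ z :+ (:- z :- y :- con one) :+ con one := x) refl x y z

-- Vertex weights are linear

Σℚ≡sum : ∀ n (f : Fin n → ℚ) → Σℚ n f ≡ sum f
Σℚ≡sum n f = trans (cong (foldr _+_ 0ℚ) (map-tabulate id f)) (foldr-tabulate f)
  where
  foldr-tabulate : ∀ {n} (f : Fin n → ℚ) → foldr _+_ 0ℚ (tabulate f) ≡ sum f
  foldr-tabulate {0}     f = refl
  foldr-tabulate {suc n} f = cong (f zero +_) (foldr-tabulate (f ∘ suc))

linComb : ∀ {m} → (Fin m → ℚ) → (Fin m → Labelling) → Labelling
linComb {m} k β e = Σℚ m λ i → k i * β i e

weight-linComb : ∀ {m} (k : Fin m → ℚ) (β : Fin m → Labelling) v →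
                 weight (linComb k β) v ≡ sum (λ i → k i * weight (β i) v)
weight-linComb {m} k β v = begin
  weight (linComb k β) v                ≡⟨ Σℚ≡sum 12 αᵥ ⟩
  sum αᵥ                                ≡⟨ sum-cong-≗ (λ e → if-linComb (incident v e) e) ⟩
  sum (λ e → sum (λ i → k i * βᵥ i e))  ≡⟨ ∑-comm (λ e i → k i * βᵥ i e) ⟩
  sum (λ i → sum (λ e → k i * βᵥ i e))  ≡⟨ sum-cong-≗ (λ i → *-distribˡ-sum (k i) (βᵥ i)) ⟨
  sum (λ i → k i * sum (βᵥ i))          ≡⟨ sum-cong-≗ (λ i → cong (k i *_) (Σℚ≡sum 12 (βᵥ i))) ⟨
  sum (λ i → k i * weight (β i) v)      ∎
  where
  αᵥ : Edge → ℚ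
  αᵥ e = if incident v e then linComb k β e else 0ℚ
  βᵥ : Fin m → Edge → ℚ
  βᵥ i e = if incident v e then β i e else 0ℚ
  if-linComb : ∀ b e →
               (if b then linComb k β e else 0ℚ) ≡ sum (λ i → k i * (if b then β i e else 0ℚ))
  if-linComb true  e = Σℚ≡sum m (λ i → k i * β i e)
  if-linComb false e = sym (trans (sum-cong-≗ (λ i → *-zeroʳ (k i))) (sum-replicate-zero m))

linComb-InSR : ∀ {m} (k : Fin m → ℚ) (β : Fin m → Labelling) →
               (∀ i → InSR (β i)) → InSR (linComb k β)
linComb-InSR k β β-magic v w = begin
  weight (linComb k β) v            ≡⟨ weight-linComb k β v ⟩
  sum (λ i → k i * weight (β i) v)  ≡⟨ sum-cong-≗ (λ i → cong (k i *_) (β-magic i v w)) ⟩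
  sum (λ i → k i * weight (β i) w)  ≡⟨ weight-linComb k β w ⟨
  weight (linComb k β) w            ∎

γ-InSR : ∀ i → InSR (γ i)
γ-InSR = toWitness {a? = all? λ i → all? λ v → all? λ w → weight (γ i) v ≟ weight (γ i) w} _

comb-InSR : ∀ k → InSR (comb k)
comb-InSR k = linComb-InSR k γ γ-InSR

-- Polynomials in k₁ … k₅ (that is var 0F … var 4F), so that comb≗label is a
-- comparison of ring-solver normal forms.
labelᵖ : Edge → Polynomial 5
labelᵖ 0F  = var 0F
labelᵖ 1F  = var 1F :+ var 3F :+ var 4F
labelᵖ 2F  = var 2F :+ var 0F :+ var 4F
labelᵖ 3F  = var 1F
labelᵖ 4F  = var 2F :+ var 3F :+ var 4F
labelᵖ 5F  = var 1F :+ var 3F :+ var 4F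
labelᵖ 6F  = var 2F :+ var 3F :+ var 4F
labelᵖ 7F  = var 3F
labelᵖ 8F  = con (ℕ→ℚ 2) :* var 3F :+ var 4F
labelᵖ 9F  = var 3F :+ var 0F :+ var 4F
labelᵖ 10F = var 1F :+ var 0F :+ var 4F
labelᵖ 11F = var 2F

label : K5 → Labelling
label k e = ⟦ labelᵖ e ⟧ (Vec.tabulate k)

combᵖ : Edge → Polynomial 5
combᵖ e = foldr (λ i p → var i :* con (γ i e) :+ p) (con 0ℚ) (allFin 5)

combᵖ≈labelᵖ : ∀ e ρ → ⟦ combᵖ e ⟧↓ ρ ≡ ⟦ labelᵖ e ⟧↓ ρ
combᵖ≈labelᵖ 0F  ρ = refl
combᵖ≈labelᵖ 1F  ρ = refl
combᵖ≈labelᵖ 2F  ρ = refl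
combᵖ≈labelᵖ 3F  ρ = refl
combᵖ≈labelᵖ 4F  ρ = refl
combᵖ≈labelᵖ 5F  ρ = refl
combᵖ≈labelᵖ 6F  ρ = refl
combᵖ≈labelᵖ 7F  ρ = refl
combᵖ≈labelᵖ 8F  ρ = refl
combᵖ≈labelᵖ 9F  ρ = refl
combᵖ≈labelᵖ 10F ρ = refl
combᵖ≈labelᵖ 11F ρ = refl

comb≗label : ∀ k e → comb k e ≡ label k e
comb≗label k e = prove (Vec.tabulate k) (combᵖ e) (labelᵖ e) (combᵖ≈labelᵖ e (Vec.tabulate k))

NatLabels : K5 → Set
NatLabels k = (e : Edge) → IsNat (label k e)

InS-comb⇔NatLabels : ∀ k → InS (comb k) ⇔ NatLabels k
InS-comb⇔NatLabels k = mk⇔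
  (λ (_ , nat) e → subst IsNat (comb≗label k e) (nat e))
  (λ nat → comb-InSR k , λ e → subst IsNat (sym (comb≗label k e)) (nat e))

natLabels : ∀ k → Base k →
            IsNat (k 1F + k 3F + k 4F) → IsNat (k 2F + k 0F + k 4F) → IsNat (k 2F + k 3F + k 4F) →
            IsNat (ℕ→ℚ 2 * k 3F + k 4F) → IsNat (k 3F + k 0F + k 4F) → IsNat (k 1F + k 0F + k 4F) →
            NatLabels k
natLabels k (k₁ , k₂ , k₃ , k₄) a₂ a₃ a₅ a₉ a₁₀ a₁₁ = labels
  where
  labels : NatLabels k
  labels 0F  = k₁
  labels 1F  = a₂
  labels 2F  = a₃
  labels 3F  = k₂
  labels 4F  = a₅
  labels 5F  = a₂
  labels 6F  = a₅
  labels 7F  = k₄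
  labels 8F  = a₉
  labels 9F  = a₁₀
  labels 10F = a₁₁
  labels 11F = k₃

IsNat⁵ : K5 → Set
IsNat⁵ x = (i : Fin 5) → IsNat (x i)

isNat⁵ : ∀ {x} → IsNat (x 0F) → IsNat (x 1F) → IsNat (x 2F) → IsNat (x 3F) → IsNat (x 4F) → IsNat⁵ x
isNat⁵ x₁ _  _  _  _  0F = x₁
isNat⁵ _  x₂ _  _  _  1F = x₂
isNat⁵ _  _  x₃ _  _  2F = x₃
isNat⁵ _  _  _  x₄ _  3F = x₄
isNat⁵ _  _  _  _  x₅ 4F = x₅

P⇒l-isNat : ∀ h k → NatLabels k → P h k → IsNat⁵ (l h k)
P⇒l-isNat a k _ ((k₁ , k₂ , k₃ , k₄) , k₅) = isNat⁵ k₁ k₂ k₃ k₄ k₅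
P⇒l-isNat b k _ ((k₁ , k₂ , k₃ , k₄) , -k₅ , -k₅≤k₁⊓k₄) =
  isNat⁵ (k+k₅ k₁ (p≤q⊓r⇒p≤q (k 0F) (k 3F) -k₅≤k₁⊓k₄)) k₂ k₃
         (k+k₅ k₄ (p≤q⊓r⇒p≤r (k 0F) (k 3F) -k₅≤k₁⊓k₄)) (isPos⇒isNat-pred -k₅)
  where
  k+k₅ : ∀ {x} → IsNat x → - k 4F ≤ x → IsNat (x + k 4F)
  k+k₅ {x} x∈ℕ -k₅≤x = subst IsNat (p-[-q]≡p+q x (k 4F)) (isNat-diff x∈ℕ (isPos⇒isNat -k₅) -k₅≤x)
P⇒l-isNat c₁ k nat ((k₁ , _ , _ , k₄) , -k₅ , k₁⊓k₄<-k₅ , k₄≤k₁) =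
  isNat⁵ (isNat-diff k₁ k₄ k₄≤k₁) (nat 1F) (nat 4F)
         (isNat-diff-1 (isPos⇒isNat -k₅) k₄ k₄<-k₅) (nat 8F)
  where
  k₄<-k₅ : k 3F < - k 4F
  k₄<-k₅ = subst (_< - k 4F) (p≥q⇒p⊓q≡q k₄≤k₁) k₁⊓k₄<-k₅
P⇒l-isNat c₂ k nat ((k₁ , k₂ , _ , k₄) , -k₅ , k₁⊓k₄<-k₅ , k₁<k₄ , 2k₁+k₅≥0) =
  isNat⁵ (nat 10F) (nat 2F) (isNat-diff-1 k₄ k₁ k₁<k₄) (isNat-diff-1 (isPos⇒isNat -k₅) k₁ k₁<-k₅)
         (isNat-nonNeg-diff (isNat-+ k₁ (nat 10F)) k₂ 2k₁+k₅≡k₁+a₁₁-k₂ 2k₁+k₅≥0)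
  where
  k₁<-k₅ : k 0F < - k 4F
  k₁<-k₅ = subst (_< - k 4F) (p≤q⇒p⊓q≡p (<⇒≤ k₁<k₄)) k₁⊓k₄<-k₅
  2k₁+k₅≡k₁+a₁₁-k₂ : ℕ→ℚ 2 * k 0F + k 4F ≡ k 0F + label k 10F - k 1F
  2k₁+k₅≡k₁+a₁₁-k₂ = solve 3 (λ k₁ k₂ k₅ → con (ℕ→ℚ 2) :* k₁ :+ k₅ := k₁ :+ (k₂ :+ k₁ :+ k₅) :- k₂)
                             refl (k 0F) (k 1F) (k 4F)
P⇒l-isNat c₃ k nat ((k₁ , _ , _ , _) , -k₅ , _ , _ , 2k₁+k₅<0) =
  isNat⁵ (nat 10F) (nat 2F) (nat 9F) k₁
         (isNat-diff-1 (isPos⇒isNat -k₅) (isNat-2* k₁) (p+q<0⇒p<-q 2k₁+k₅<0))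

l-isNat⇒P-a : ∀ k → IsNat⁵ (l a k) → NatLabels k × P a k
l-isNat⇒P-a k n = natLabels k base a₂ a₃ a₅ a₉ a₁₀ a₁₁ , base , n 4F
  where
  base : Base k
  base = n 0F , n 1F , n 2F , n 3F
  a₂ : IsNat (k 1F + k 3F + k 4F)
  a₂ = isNat-+ (isNat-+ (n 1F) (n 3F)) (n 4F)
  a₃ : IsNat (k 2F + k 0F + k 4F)
  a₃ = isNat-+ (isNat-+ (n 2F) (n 0F)) (n 4F)
  a₅ : IsNat (k 2F + k 3F + k 4F)
  a₅ = isNat-+ (isNat-+ (n 2F) (n 3F)) (n 4F)
  a₉ : IsNat (ℕ→ℚ 2 * k 3F + k 4F)
  a₉ = isNat-+ (isNat-2* (n 3F)) (n 4F)
  a₁₀ : IsNat (k 3F + k 0F + k 4F)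
  a₁₀ = isNat-+ (isNat-+ (n 3F) (n 0F)) (n 4F)
  a₁₁ : IsNat (k 1F + k 0F + k 4F)
  a₁₁ = isNat-+ (isNat-+ (n 1F) (n 0F)) (n 4F)

l-isNat⇒P-b : ∀ k → IsNat⁵ (l b k) → NatLabels k × P b k
l-isNat⇒P-b k n =
  natLabels k base a₂ a₃ a₅ a₉ a₁₀ a₁₁ , base , -k₅ , -k₅≤k₁⊓k₄
  where
  -k₅ : IsPos (- k 4F)
  -k₅ = isNat-pred⇒isPos (n 4F)
  k₁+k₅ : IsNat (k 0F - - k 4F)
  k₁+k₅ = subst IsNat (sym (p-[-q]≡p+q (k 0F) (k 4F))) (n 0F)
  k₄+k₅ : IsNat (k 3F - - k 4F)
  k₄+k₅ = subst IsNat (sym (p-[-q]≡p+q (k 3F) (k 4F))) (n 3F)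
  k₄ : IsNat (k 3F)
  k₄ = isNat-diff⇒isNat k₄+k₅ (isPos⇒isNat -k₅)
  base : Base k
  base = isNat-diff⇒isNat k₁+k₅ (isPos⇒isNat -k₅) , n 1F , n 2F , k₄
  -k₅≤k₁⊓k₄ : - k 4F ≤ k 0F ⊓ k 3F
  -k₅≤k₁⊓k₄ = ⊓-glb {y = k 0F} {z = k 3F} (isNat-diff⇒≤ k₁+k₅) (isNat-diff⇒≤ k₄+k₅)
  a₂ : IsNat (k 1F + k 3F + k 4F)
  a₂ = isNat-+-assoc (k 3F) (k 4F) (n 1F) (n 3F)
  a₃ : IsNat (k 2F + k 0F + k 4F)
  a₃ = isNat-+-assoc (k 0F) (k 4F) (n 2F) (n 0F)
  a₅ : IsNat (k 2F + k 3F + k 4F)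
  a₅ = isNat-+-assoc (k 3F) (k 4F) (n 2F) (n 3F)
  a₉ : IsNat (ℕ→ℚ 2 * k 3F + k 4F)
  a₉ = isNat-2*-+ (k 3F) (k 4F) (isNat-+-assoc (k 3F) (k 4F) k₄ (n 3F))
  a₁₀ : IsNat (k 3F + k 0F + k 4F)
  a₁₀ = isNat-+-assoc (k 0F) (k 4F) k₄ (n 0F)
  a₁₁ : IsNat (k 1F + k 0F + k 4F)
  a₁₁ = isNat-+-assoc (k 0F) (k 4F) (n 1F) (n 0F)

l-isNat⇒P-c₁ : ∀ k → IsNat⁵ (l c₁ k) → NatLabels k × P c₁ k
l-isNat⇒P-c₁ k n =
  natLabels k base (n 1F) a₃ (n 2F) (n 4F) a₁₀ a₁₁ , base , -k₅ , k₁⊓k₄<-k₅ , k₄≤k₁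
  where
  l₄+l₅+1≡k₄ : l c₁ k 3F + l c₁ k 4F + one ≡ k 3F
  l₄+l₅+1≡k₄ = solve 2 (λ k₄ k₅ → (:- k₅ :- k₄ :- con one) :+ (con (ℕ→ℚ 2) :* k₄ :+ k₅) :+ con one
                                  := k₄)
                       refl (k 3F) (k 4F)
  k₄ : IsNat (k 3F)
  k₄ = subst IsNat l₄+l₅+1≡k₄ (isNat-+ (isNat-+ (n 3F) (n 4F)) isNat-1)
  -k₅ : IsPos (- k 4F)
  -k₅ = isNat-diff-1⇒isPos (n 3F) k₄
  base : Base k
  base = isNat-diff⇒isNat (n 0F) k₄ , isNat-cancel (k 3F) (k 4F) (n 1F) (n 3F) ,
         isNat-cancel (k 3F) (k 4F) (n 2F) (n 3F) , k₄
  k₄≤k₁ : k 3F ≤ k 0F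
  k₄≤k₁ = isNat-diff⇒≤ (n 0F)
  k₁⊓k₄<-k₅ : k 0F ⊓ k 3F < - k 4F
  k₁⊓k₄<-k₅ = subst (_< - k 4F) (sym (p≥q⇒p⊓q≡q k₄≤k₁)) (isNat-diff-1⇒< (n 3F))
  a₃ : IsNat (k 2F + k 0F + k 4F)
  a₃ = isNat-exchange (k 2F) (k 3F) (k 4F) (k 0F) (n 2F) (n 0F)
  a₁₀ : IsNat (k 3F + k 0F + k 4F)
  a₁₀ = isNat-exchange (k 3F) (k 3F) (k 4F) (k 0F) (isNat-2*-+⁻ (k 3F) (k 4F) (n 4F)) (n 0F)
  a₁₁ : IsNat (k 1F + k 0F + k 4F)
  a₁₁ = isNat-exchange (k 1F) (k 3F) (k 4F) (k 0F) (n 1F) (n 0F)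

l-isNat⇒P-c₂ : ∀ k → IsNat⁵ (l c₂ k) → NatLabels k × P c₂ k
l-isNat⇒P-c₂ k n =
  natLabels k base a₂ (n 1F) a₅ a₉ a₁₀ (n 0F) , base , -k₅ , k₁⊓k₄<-k₅ , k₁<k₄ , isNat⇒nonNeg (n 4F)
  where
  l₄+l₅+1≡k₁ : l c₂ k 3F + l c₂ k 4F + one ≡ k 0F
  l₄+l₅+1≡k₁ = solve 2 (λ k₁ k₅ → (:- k₅ :- k₁ :- con one) :+ (con (ℕ→ℚ 2) :* k₁ :+ k₅) :+ con one
                                  := k₁)
                       refl (k 0F) (k 4F)
  k₁ : IsNat (k 0F)
  k₁ = subst IsNat l₄+l₅+1≡k₁ (isNat-+ (isNat-+ (n 3F) (n 4F)) isNat-1)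
  -k₅ : IsPos (- k 4F)
  -k₅ = isNat-diff-1⇒isPos (n 3F) k₁
  k₄ : IsNat (k 3F)
  k₄ = isPos⇒isNat (isNat-diff-1⇒isPos (n 2F) k₁)
  base : Base k
  base = k₁ , isNat-cancel (k 0F) (k 4F) (n 0F) (n 3F) ,
         isNat-cancel (k 0F) (k 4F) (n 1F) (n 3F) , k₄
  k₁<k₄ : k 0F < k 3F
  k₁<k₄ = isNat-diff-1⇒< (n 2F)
  k₁⊓k₄<-k₅ : k 0F ⊓ k 3F < - k 4F
  k₁⊓k₄<-k₅ = subst (_< - k 4F) (sym (p≤q⇒p⊓q≡p (<⇒≤ k₁<k₄))) (isNat-diff-1⇒< (n 3F))
  k₄-k₁ : IsNat (k 3F - k 0F)
  k₄-k₁ = isNat-diff k₄ k₁ (<⇒≤ k₁<k₄)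
  a₂ : IsNat (k 1F + k 3F + k 4F)
  a₂ = isNat-exchange (k 1F) (k 0F) (k 4F) (k 3F) (n 0F) k₄-k₁
  a₅ : IsNat (k 2F + k 3F + k 4F)
  a₅ = isNat-exchange (k 2F) (k 0F) (k 4F) (k 3F) (n 1F) k₄-k₁
  a₁₀ : IsNat (k 3F + k 0F + k 4F)
  a₁₀ = subst IsNat (cong (_+ k 4F) (+-comm (k 0F) (k 3F)))
              (isNat-exchange (k 0F) (k 0F) (k 4F) (k 3F) (isNat-2*-+⁻ (k 0F) (k 4F) (n 4F)) k₄-k₁)
  a₉ : IsNat (ℕ→ℚ 2 * k 3F + k 4F)
  a₉ = isNat-2*-+ (k 3F) (k 4F) (isNat-exchange (k 3F) (k 0F) (k 4F) (k 3F) a₁₀ k₄-k₁)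

l-isNat⇒P-c₃ : ∀ k → IsNat⁵ (l c₃ k) → NatLabels k × P c₃ k
l-isNat⇒P-c₃ k n =
  natLabels k base a₂ (n 1F) a₅ a₉ (n 2F) (n 0F) , base , -k₅ , k₁⊓k₄<-k₅ , k₁<k₄ , 2k₁+k₅<0
  where
  k₁ : IsNat (k 0F)
  k₁ = n 3F
  -k₅ : IsPos (- k 4F)
  -k₅ = isNat-diff-1⇒isPos (n 4F) (isNat-2* k₁)
  l₅+l₄≡-k₅-k₁-1 : l c₃ k 4F + l c₃ k 3F ≡ - k 4F - k 0F - one
  l₅+l₄≡-k₅-k₁-1 = solve 2 (λ k₁ k₅ → (:- k₅ :- con (ℕ→ℚ 2) :* k₁ :- con one) :+ k₁
                                      := :- k₅ :- k₁ :- con one)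
                           refl (k 0F) (k 4F)
  -k₅-k₁-1 : IsNat (- k 4F - k 0F - one)
  -k₅-k₁-1 = subst IsNat l₅+l₄≡-k₅-k₁-1 (isNat-+ (n 4F) (n 3F))
  k₄ : IsNat (k 3F)
  k₄ = isNat-cancel (k 0F) (k 4F) (n 2F) -k₅-k₁-1
  base : Base k
  base = k₁ , isNat-cancel (k 0F) (k 4F) (n 0F) -k₅-k₁-1 ,
         isNat-cancel (k 0F) (k 4F) (n 1F) -k₅-k₁-1 , k₄
  l₃+l₅≡k₄-k₁-1 : l c₃ k 2F + l c₃ k 4F ≡ k 3F - k 0F - one
  l₃+l₅≡k₄-k₁-1 = solve 3 (λ k₁ k₄ k₅ → (k₄ :+ k₁ :+ k₅) :+ (:- k₅ :- con (ℕ→ℚ 2) :* k₁ :- con one)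
                                     := k₄ :- k₁ :- con one)
                          refl (k 0F) (k 3F) (k 4F)
  k₁<k₄ : k 0F < k 3F
  k₁<k₄ = isNat-diff-1⇒< (subst IsNat l₃+l₅≡k₄-k₁-1 (isNat-+ (n 2F) (n 4F)))
  k₁⊓k₄<-k₅ : k 0F ⊓ k 3F < - k 4F
  k₁⊓k₄<-k₅ = subst (_< - k 4F) (sym (p≤q⇒p⊓q≡p (<⇒≤ k₁<k₄))) (isNat-diff-1⇒< -k₅-k₁-1)
  2k₁+k₅<0 : ℕ→ℚ 2 * k 0F + k 4F < 0ℚ
  2k₁+k₅<0 = p<-q⇒p+q<0 {ℕ→ℚ 2 * k 0F} {k 4F} (isNat-diff-1⇒< (n 4F))
  k₄-k₁ : IsNat (k 3F - k 0F)
  k₄-k₁ = isNat-diff k₄ k₁ (<⇒≤ k₁<k₄)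
  a₂ : IsNat (k 1F + k 3F + k 4F)
  a₂ = isNat-exchange (k 1F) (k 0F) (k 4F) (k 3F) (n 0F) k₄-k₁
  a₅ : IsNat (k 2F + k 3F + k 4F)
  a₅ = isNat-exchange (k 2F) (k 0F) (k 4F) (k 3F) (n 1F) k₄-k₁
  a₉ : IsNat (ℕ→ℚ 2 * k 3F + k 4F)
  a₉ = isNat-2*-+ (k 3F) (k 4F) (isNat-exchange (k 3F) (k 0F) (k 4F) (k 3F) (n 2F) k₄-k₁)

l-isNat⇒P : ∀ h k → IsNat⁵ (l h k) → NatLabels k × P h k
l-isNat⇒P a  = l-isNat⇒P-a
l-isNat⇒P b  = l-isNat⇒P-b
l-isNat⇒P c₁ = l-isNat⇒P-c₁
l-isNat⇒P c₂ = l-isNat⇒P-c₂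
l-isNat⇒P c₃ = l-isNat⇒P-c₃

mainTheorem6 : (h : H) (k : K5) →
    (InS (comb k) × P h k) ⇔ ((i : Fin 5) → IsNat (l h k i))
mainTheorem6 h k = mk⇔
  (λ (s , p) → P⇒l-isNat h k (Equivalence.to (InS-comb⇔NatLabels k) s) p)
  (λ n → map₁ (Equivalence.from (InS-comb⇔NatLabels k)) (l-isNat⇒P h k n))
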